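{- Let $\delta,K_1,K_2,C_0,C_1$ be admissible parameters. Then the set of magic distances equals $\{a\in\{1,\dots,\delta\}:$ the triangle $(a,a,b)$ is allowed for every $b\in\{1,\dots,\delta\}\}$.
   Context: Parameters $\delta,K_1,K_2,C_0,C_1$ are positive integers; acceptable if $3\le\delta<\infty$, $1\le K_1\le K_2\le\delta$, $2\delta+2\le C_0,C_1\le 3\delta+2$, $C_0$ even, $C_1$ odd. $C=\min(C_0,C_1)$, $C'=\max(C_0,C_1)$. Admissible: acceptable and either (II) $C\le 2\delta+K_1$, $C=2K_1+2K_2+1$, $K_1+K_2\ge\delta$, $K_1+2K_2\le 2\delta-1$, and either (IIA) $C'=C+1$ or (IIB) $C'>C+1$, $K_1=K_2$, $3K_2=2\delta-1$; or (III) $C\ge 2\delta+K_1+1$, $K_1+2K_2\ge 2\delta-1$, $3K_2\ge 2\delta$, if $K_1+2K_2=2\delta-1$ then $C\ge 2\delta+K_1+2$, and if $C'>C+1$ then $C\ge 2\delta+K_2$. $\mathcal{A}^\delta_{K_1,K_2,C_0,C_1}$: finite metric spaces with distances in $\{0,\dots,\delta\}$ such that for every three distinct points with perimeter $p$ and smallest distance $m$: if $p$ odd then $2K_1<p$, $p<2K_2+2m$, $p<C_1$; if $p$ even then $p<C_0$. A triangle $(a,b,c)$ with $a,b,c\in\{1,\dots,\delta\}$ is allowed if the three-point space with pairwise distances $a,b,c$ (a metric space only if the triangle inequalities hold) belongs to $\mathcal{A}^\delta_{K_1,K_2,C_0,C_1}$, and forbidden otherwise. A distance $M\in\{1,\dots,\delta\}$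 is magic if $\max(K_1,\lceil\delta/2\rceil)\le M\le\min(K_2,\lfloor(C-\delta-1)/2\rfloor)$. -}

module Defs where

open import Data.Nat using (ℕ; zero; suc; _+_; _*_; _∸_; _≤_; _<_; _⊓_; _⊔_; ⌊_/2⌋; ⌈_/2⌉)
open import Data.Nat.DivMod using (_%_)
open import Data.Fin using (Fin; zero; suc)
open import Data.Product using (_×_)
open import Relation.Binary.PropositionalEquality using (_≡_; _≢_)

Odd Even : ℕ → Set
Odd p = p % 2 ≡ 1
Even p = p % 2 ≡ 0

record Params : Set where
  constructor params
  field
    δ K₁ K₂ C₀ C₁ : ℕ

module _ (P : Params) where
  open Params P

  C C' : ℕ
  C = C₀ ⊓ C₁
  C' = C₀ ⊔ C₁

  Acceptable : Set
  Acceptable =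
    3 ≤ δ × 1 ≤ K₁ × K₁ ≤ K₂ × K₂ ≤ δ ×
    2 * δ + 2 ≤ C₀ × C₀ ≤ 3 * δ + 2 ×
    2 * δ + 2 ≤ C₁ × C₁ ≤ 3 * δ + 2 ×
    Even C₀ × Odd C₁

  data CaseII-sub : Set where
    IIA : C' ≡ C + 1 → CaseII-sub
    IIB : C + 1 < C' → K₁ ≡ K₂ → 3 * K₂ ≡ 2 * δ ∸ 1 → CaseII-sub

  CaseII : Set
  CaseII =
    C ≤ 2 * δ + K₁ × C ≡ 2 * K₁ + 2 * K₂ + 1 × δ ≤ K₁ + K₂ ×
    K₁ + 2 * K₂ ≤ 2 * δ ∸ 1 × CaseII-sub

  CaseIII : Set
  CaseIII =
    2 * δ + K₁ + 1 ≤ C × 2 * δ ∸ 1 ≤ K₁ + 2 * K₂ × 2 * δ ≤ 3 * K₂ ×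
    (K₁ + 2 * K₂ ≡ 2 * δ ∸ 1 → 2 * δ + K₁ + 2 ≤ C) ×
    (C + 1 < C' → 2 * δ + K₂ ≤ C)

  data Case : Set where
    caseII  : CaseII → Case
    caseIII : CaseIII → Case

  Admissible : Set
  Admissible = Acceptable × Case

  record IsBoundedMetric {n : ℕ} (d : Fin n → Fin n → ℕ) : Set where
    field
      dist-self : ∀ x → d x x ≡ 0
      dist-pos  : ∀ x y → d x y ≡ 0 → x ≡ y
      dist-sym  : ∀ x y → d x y ≡ d y x
      dist-tri  : ∀ x y z → d x z ≤ d x y + d y z
      dist-bnd  : ∀ x y → d x y ≤ δ

  TriangleCond : ℕ → ℕ → Set
  TriangleCond p m =
    (Odd p → 2 * K₁ < p × p < 2 * K₂ + 2 * m × p < C₁) ×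
    (Even p → p < C₀)

  InClass : {n : ℕ} → (Fin n → Fin n → ℕ) → Set
  InClass {n} d =
    IsBoundedMetric d ×
    (∀ x y z → x ≢ y → y ≢ z → x ≢ z →
       TriangleCond (d x y + d y z + d x z) ((d x y ⊓ d y z) ⊓ d x z))

  threePoint : ℕ → ℕ → ℕ → Fin 3 → Fin 3 → ℕ
  threePoint a b c zero zero = 0
  threePoint a b c zero (suc zero) = a
  threePoint a b c zero (suc (suc zero)) = c
  threePoint a b c (suc zero) zero = a
  threePoint a b c (suc zero) (suc zero) = 0
  threePoint a b c (suc zero) (suc (suc zero)) = b
  threePoint a b c (suc (suc zero)) zero = c
  threePoint a b c (suc (suc zero)) (suc zero) = b
  threePoint a b c (suc (suc zero)) (suc (suc zero)) = 0

  Allowed : ℕ → ℕ → ℕ → Set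
  Allowed a b c = InClass (threePoint a b c)

  InRange : ℕ → Set
  InRange x = 1 ≤ x × x ≤ δ

  Magic : ℕ → Set
  Magic M = InRange M × K₁ ⊔ ⌈ δ /2⌉ ≤ M × M ≤ K₂ ⊓ ⌊ C ∸ δ ∸ 1 /2⌋

module Submission where

-- The triangles (a, a, b) with 1 ≤ b ≤ δ are always metric once δ ≤ 2a, and
-- their perimeters are 2a + b. Taking b = δ gives δ ≤ 2a; taking b = 1 gives
-- the odd perimeter 2a + 1, whence 2K₁ < 2a + 1 < 2K₂ + 2, i.e. K₁ ≤ a ≤ K₂;
-- taking b = δ − 1 and b = δ gives two consecutive perimeters, one even and
-- one odd, which together with C₀ even and C₁ odd forces 2a + δ < min(C₀, C₁).
-- These four bounds are exactly the magic inequalities. Conversely they make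
-- every perimeter 2a + b < C, and an odd one lies above 2K₁ and below
-- 2K₂ + 2 min(a, b).

open import Defs
open import Data.Nat using (ℕ; suc; _+_; _*_; _∸_; _≤_; _<_; _⊓_; ⌊_/2⌋; ⌈_/2⌉; z≤n; s≤s)
open import Data.Nat.Properties
open import Data.Nat.DivMod using (_%_; m%n<n; m*n%n≡0; %-distribˡ-+; [m+kn]%n≡m%n)
open import Data.Fin using (Fin)
open import Data.Fin.Patterns using (0F; 1F; 2F)
open import Data.Product using (_×_; _,_; proj₁; proj₂)
open import Data.Sum using (_⊎_; inj₁; inj₂)
open import Function.Bundles using (_⇔_; mk⇔; Equivalence)
open import Relation.Binary.PropositionalEquality
open import Relation.Nullary using (contradiction)
import Algebra.Properties.CommutativeSemigroup as CommSemigroupProperties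

private
  variable
    m n o : ℕ

2*n≡n+n : ∀ n → 2 * n ≡ n + n
2*n≡n+n n = cong (n +_) (+-identityʳ n)

even⊎odd : ∀ n → Even n ⊎ Odd n
even⊎odd n with n % 2 | m%n<n n 2
... | 0 | _ = inj₁ refl
... | 1 | _ = inj₂ refl
... | suc (suc _) | s≤s (s≤s ())

even⇒odd-suc : Even n → Odd (suc n)
even⇒odd-suc {n} e = trans (%-distribˡ-+ 1 n 2) (cong (λ r → (1 + r) % 2) e)

odd⇒even-suc : Odd n → Even (suc n)
odd⇒even-suc {n} o = trans (%-distribˡ-+ 1 n 2) (cong (λ r → (1 + r) % 2) o)

even-2* : ∀ n → Even (2 * n)
even-2* n = trans (cong (_% 2) (*-comm 2 n)) (m*n%n≡0 n 2)

[2*m+n]%2≡n%2 : ∀ m n → (2 * m + n) % 2 ≡ n % 2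
[2*m+n]%2≡n%2 m n = trans (cong (_% 2) (trans (+-comm (2 * m) n) (cong (n +_) (*-comm 2 m))))
                          ([m+kn]%n≡m%n n m 2)

n%2≢[1+n]%2 : ∀ n → n % 2 ≢ suc n % 2
n%2≢[1+n]%2 n eq with even⊎odd n
... | inj₁ e = 0≢1+n (trans (sym e) (trans eq (even⇒odd-suc {n} e)))
... | inj₂ o = 0≢1+n (trans (sym (odd⇒even-suc {n} o)) (trans (sym eq) o))

same-parity-<⇒suc< : m % 2 ≡ n % 2 → m < n → suc m < n
same-parity-<⇒suc< {m} eq m<n with m≤n⇒m<n∨m≡n m<n
... | inj₁ sm<n = sm<n
... | inj₂ refl = contradiction eq (n%2≢[1+n]%2 m)

≤⌊n/2⌋⇔2*≤ : ∀ m n → m ≤ ⌊ n /2⌋ ⇔ 2 * m ≤ n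
≤⌊n/2⌋⇔2*≤ m n = mk⇔
  (λ m≤ → subst (_≤ n) (sym (2*n≡n+n m))
            (≤-trans (+-mono-≤ m≤ (≤-trans m≤ (⌊n/2⌋≤⌈n/2⌉ n))) (≤-reflexive (⌊n/2⌋+⌈n/2⌉≡n n))))
  (λ 2m≤n → subst (_≤ ⌊ n /2⌋) (sym (n≡⌊n+n/2⌋ m))
              (⌊n/2⌋-mono (subst (_≤ n) (2*n≡n+n m) 2m≤n)))

⌈n/2⌉≤⇔≤2* : ∀ m n → ⌈ n /2⌉ ≤ m ⇔ n ≤ 2 * m
⌈n/2⌉≤⇔≤2* m n = mk⇔
  (λ ≤m → subst (n ≤_) (sym (2*n≡n+n m))
            (≤-trans (≤-reflexive (sym (⌊n/2⌋+⌈n/2⌉≡n n))) (+-mono-≤ (≤-trans (⌊n/2⌋≤⌈n/2⌉ n) ≤m) ≤m)))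
  (λ n≤2m → subst (⌈ n /2⌉ ≤_) (sym (n≡⌈n+n/2⌉ m))
              (⌈n/2⌉-mono (subst (n ≤_) (2*n≡n+n m) n≤2m)))

-- Truncated subtraction: positivity of m rules out the junk case o ∸ n ∸ 1 = 0.
≤∸∸1⇔+< : 0 < m → m ≤ o ∸ n ∸ 1 ⇔ m + n < o
≤∸∸1⇔+< {m} {o} {n} 0<m = mk⇔ to from
  where
  m+[n+1]≡1+m+n : m + (n + 1) ≡ suc (m + n)
  m+[n+1]≡1+m+n = trans (cong (m +_) (+-comm n 1)) (+-suc m n)

  to : m ≤ o ∸ n ∸ 1 → m + n < o
  to m≤ = subst (_≤ o) m+[n+1]≡1+m+n (m≤o∸n⇒m+n≤o m n+1≤o m≤o∸[n+1])
    where
    m≤o∸[n+1] : m ≤ o ∸ (n + 1)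
    m≤o∸[n+1] = subst (m ≤_) (∸-+-assoc o n 1) m≤
    n+1≤o : n + 1 ≤ o
    n+1≤o = <⇒≤ (m∸n≢0⇒n<m (>⇒≢ (<-≤-trans 0<m m≤o∸[n+1])))

  from : m + n < o → m ≤ o ∸ n ∸ 1
  from m+n<o = subst (m ≤_) (sym (∸-+-assoc o n 1))
                 (m+n≤o⇒m≤o∸n m (subst (_≤ o) (sym m+[n+1]≡1+m+n) m+n<o))

2*m<2*n+1⇒m≤n : 2 * m < 2 * n + 1 → m ≤ n
2*m<2*n+1⇒m≤n {m} {n} lt = *-cancelˡ-≤ 2 (m<1+n⇒m≤n (subst (2 * m <_) (+-comm (2 * n) 1) lt))

2*m+1<2*n+2⇒m≤n : 2 * m + 1 < 2 * n + 2 → m ≤ n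
2*m+1<2*n+2⇒m≤n {m} {n} lt =
  *-cancelˡ-≤ 2 (≤-pred (≤-pred (subst₂ _<_ (+-comm (2 * m) 1) (+-comm (2 * n) 2) lt)))

module _ (P : Params) where
  open Params P
  private
    module +ₚ = CommSemigroupProperties +-commutativeSemigroup
    module ⊓ₚ = CommSemigroupProperties ⊓-commutativeSemigroup

  allowed-threePoint⁺ : ∀ {a b c} → InRange P a → InRange P b → InRange P c →
    c ≤ a + b → a ≤ b + c → b ≤ c + a →
    TriangleCond P (a + b + c) ((a ⊓ b) ⊓ c) → Allowed P a b c
  allowed-threePoint⁺ {a} {b} {c} (1≤a , a≤δ) (1≤b , b≤δ) (1≤c , c≤δ) c≤a+b a≤b+c b≤c+a T =
    record { dist-self = self ; dist-pos = pos ; dist-sym = symm ; dist-tri = tri ; dist-bnd = bnd } , tc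
    where
    d : Fin 3 → Fin 3 → ℕ
    d = threePoint P a b c

    self : ∀ x → d x x ≡ 0
    self 0F = refl
    self 1F = refl
    self 2F = refl

    side≢0 : ∀ {s} → 1 ≤ s → s ≢ 0
    side≢0 1≤s refl = contradiction 1≤s λ ()

    pos : ∀ x y → d x y ≡ 0 → x ≡ y
    pos 0F 0F _ = refl
    pos 0F 1F e = contradiction e (side≢0 1≤a)
    pos 0F 2F e = contradiction e (side≢0 1≤c)
    pos 1F 0F e = contradiction e (side≢0 1≤a)
    pos 1F 1F _ = refl
    pos 1F 2F e = contradiction e (side≢0 1≤b)
    pos 2F 0F e = contradiction e (side≢0 1≤c)
    pos 2F 1F e = contradiction e (side≢0 1≤b)
    pos 2F 2F _ = refl

    symm : ∀ x y → d x y ≡ d y x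
    symm 0F 0F = refl
    symm 0F 1F = refl
    symm 0F 2F = refl
    symm 1F 0F = refl
    symm 1F 1F = refl
    symm 1F 2F = refl
    symm 2F 0F = refl
    symm 2F 1F = refl
    symm 2F 2F = refl

    bnd : ∀ x y → d x y ≤ δ
    bnd 0F 0F = z≤n
    bnd 0F 1F = a≤δ
    bnd 0F 2F = c≤δ
    bnd 1F 0F = a≤δ
    bnd 1F 1F = z≤n
    bnd 1F 2F = b≤δ
    bnd 2F 0F = c≤δ
    bnd 2F 1F = b≤δ
    bnd 2F 2F = z≤n

    tri : ∀ x y z → d x z ≤ d x y + d y z
    tri 0F 0F _  = ≤-refl
    tri 1F 1F _  = ≤-refl
    tri 2F 2F _  = ≤-refl
    tri x  0F 0F = m≤m+n (d x 0F) 0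
    tri x  1F 1F = m≤m+n (d x 1F) 0
    tri x  2F 2F = m≤m+n (d x 2F) 0
    tri 0F _  0F = z≤n
    tri 1F _  1F = z≤n
    tri 2F _  2F = z≤n
    tri 0F 1F 2F = c≤a+b
    tri 0F 2F 1F = subst (a ≤_) (+-comm b c) a≤b+c
    tri 1F 0F 2F = subst (b ≤_) (+-comm c a) b≤c+a
    tri 1F 2F 0F = a≤b+c
    tri 2F 0F 1F = b≤c+a
    tri 2F 1F 0F = subst (c ≤_) (+-comm a b) c≤a+b

    tc : ∀ x y z → x ≢ y → y ≢ z → x ≢ z →
         TriangleCond P (d x y + d y z + d x z) ((d x y ⊓ d y z) ⊓ d x z)
    tc 0F 0F _  x≢y _ _ = contradiction refl x≢y
    tc 1F 1F _  x≢y _ _ = contradiction refl x≢y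
    tc 2F 2F _  x≢y _ _ = contradiction refl x≢y
    tc _  0F 0F _ y≢z _ = contradiction refl y≢z
    tc _  1F 1F _ y≢z _ = contradiction refl y≢z
    tc _  2F 2F _ y≢z _ = contradiction refl y≢z
    tc 0F _  0F _ _ x≢z = contradiction refl x≢z
    tc 1F _  1F _ _ x≢z = contradiction refl x≢z
    tc 2F _  2F _ _ x≢z = contradiction refl x≢z
    tc 0F 1F 2F _ _ _ = T
    tc 0F 2F 1F _ _ _ = subst₂ (TriangleCond P) (+ₚ.xy∙z≈zy∙x a b c) (⊓ₚ.xy∙z≈zy∙x a b c) T
    tc 1F 0F 2F _ _ _ = subst₂ (TriangleCond P) (+ₚ.xy∙z≈xz∙y a b c) (⊓ₚ.xy∙z≈xz∙y a b c) T
    tc 1F 2F 0F _ _ _ = subst₂ (TriangleCond P) (+ₚ.xy∙z≈yz∙x a b c) (⊓ₚ.xy∙z≈yz∙x a b c) T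
    tc 2F 0F 1F _ _ _ = subst₂ (TriangleCond P) (+ₚ.xy∙z≈zx∙y a b c) (⊓ₚ.xy∙z≈zx∙y a b c) T
    tc 2F 1F 0F _ _ _ = subst₂ (TriangleCond P) (+ₚ.xy∙z≈yx∙z a b c) (⊓ₚ.xy∙z≈yx∙z a b c) T

  allowed-threePoint⁻ : ∀ {a b c} → Allowed P a b c →
    c ≤ a + b × TriangleCond P (a + b + c) ((a ⊓ b) ⊓ c)
  allowed-threePoint⁻ (metric , triangles) =
    IsBoundedMetric.dist-tri metric 0F 1F 2F , triangles 0F 1F 2F (λ ()) (λ ()) (λ ())

  allowed-isosceles⁺ : ∀ {a b} → InRange P a → InRange P b → b ≤ 2 * a →
    TriangleCond P (2 * a + b) (a ⊓ b) → Allowed P a a b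
  allowed-isosceles⁺ {a} {b} ra rb b≤2a T =
    allowed-threePoint⁺ ra ra rb (subst (b ≤_) (2*n≡n+n a) b≤2a) (m≤m+n a b) (m≤n+m a b)
      (subst₂ (TriangleCond P) (cong (_+ b) (2*n≡n+n a)) (cong (_⊓ b) (sym (⊓-idem a))) T)

  allowed-isosceles⁻ : ∀ {a b} → Allowed P a a b → b ≤ 2 * a × TriangleCond P (2 * a + b) (a ⊓ b)
  allowed-isosceles⁻ {a} {b} allowed with allowed-threePoint⁻ allowed
  ... | b≤a+a , T = subst (b ≤_) (sym (2*n≡n+n a)) b≤a+a
                  , subst₂ (TriangleCond P) (cong (_+ b) (sym (2*n≡n+n a))) (cong (_⊓ b) (⊓-idem a)) T

  record MagicBounds (a : ℕ) : Set where
    field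
      K₁≤a    : K₁ ≤ a
      δ≤2*a   : δ ≤ 2 * a
      a≤K₂    : a ≤ K₂
      2*a+δ<C : 2 * a + δ < C P

  magic⇔magicBounds : ∀ {a} → Magic P a ⇔ (InRange P a × MagicBounds a)
  magic⇔magicBounds {a} = mk⇔
    (λ (ra , lo , hi) → ra , record
      { K₁≤a    = m⊔n≤o⇒m≤o K₁ ⌈ δ /2⌉ lo
      ; δ≤2*a   = Equivalence.to (⌈n/2⌉≤⇔≤2* a δ) (m⊔n≤o⇒n≤o K₁ ⌈ δ /2⌉ lo)
      ; a≤K₂    = m≤n⊓o⇒m≤n K₂ ⌊ C P ∸ δ ∸ 1 /2⌋ hi
      ; 2*a+δ<C = Equivalence.to (≤∸∸1⇔+< (0<2*a ra))
                    (Equivalence.to (≤⌊n/2⌋⇔2*≤ a _) (m≤n⊓o⇒m≤o K₂ ⌊ C P ∸ δ ∸ 1 /2⌋ hi))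
      })
    (λ (ra , mb) → let open MagicBounds mb in
      ra , ⊔-lub K₁≤a (Equivalence.from (⌈n/2⌉≤⇔≤2* a δ) δ≤2*a)
         , ⊓-glb a≤K₂ (Equivalence.from (≤⌊n/2⌋⇔2*≤ a _)
                         (Equivalence.from (≤∸∸1⇔+< (0<2*a ra)) 2*a+δ<C)))
    where
    0<2*a : InRange P a → 0 < 2 * a
    0<2*a (1≤a , _) = ≤-trans (s≤s z≤n) (*-monoʳ-≤ 2 1≤a)

  magicBounds⇒triangleCond : ∀ {a b} → MagicBounds a → InRange P b →
    TriangleCond P (2 * a + b) (a ⊓ b)
  magicBounds⇒triangleCond {a} {b} mb (1≤b , b≤δ) = odd-case , λ _ → m<n⊓o⇒m<n C₀ C₁ p<C
    where
    open MagicBounds mb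
    p<C : 2 * a + b < C P
    p<C = ≤-<-trans (+-monoʳ-≤ (2 * a) b≤δ) 2*a+δ<C

    p<2*K₂+2*min : Odd (2 * a + b) → 2 * a + b < 2 * K₂ + 2 * (a ⊓ b)
    p<2*K₂+2*min odd with ≤-total a b
    ... | inj₂ b≤a rewrite m≥n⇒m⊓n≡n b≤a =
      +-mono-≤-< (*-monoʳ-≤ 2 a≤K₂) (subst (b <_) (sym (2*n≡n+n b)) (m<m+n b 1≤b))
    ... | inj₁ a≤b rewrite m≤n⇒m⊓n≡m a≤b =
      subst (2 * a + b <_) (+-comm (2 * a) (2 * K₂)) (+-monoʳ-< (2 * a) b<2*K₂)
      where
      -- b ≤ δ ≤ 2a ≤ 2K₂, and b is odd.
      b<2*K₂ : b < 2 * K₂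
      b<2*K₂ with m≤n⇒m<n∨m≡n (≤-trans b≤δ (≤-trans δ≤2*a (*-monoʳ-≤ 2 a≤K₂)))
      ... | inj₁ b< = b<
      ... | inj₂ refl = contradiction (trans (sym (even-2* K₂)) (trans (sym ([2*m+n]%2≡n%2 a b)) odd)) 0≢1+n

    odd-case : Odd (2 * a + b) →
      2 * K₁ < 2 * a + b × 2 * a + b < 2 * K₂ + 2 * (a ⊓ b) × 2 * a + b < C₁
    odd-case odd = ≤-<-trans (*-monoʳ-≤ 2 K₁≤a) (m<m+n (2 * a) 1≤b)
                 , p<2*K₂+2*min odd
                 , m<n⊓o⇒m<o C₀ C₁ p<C

  magicBounds⇒allowed-isosceles : ∀ {a} → InRange P a → MagicBounds a →
    ∀ b → InRange P b → Allowed P a a b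
  magicBounds⇒allowed-isosceles ra bounds b rb =
    allowed-isosceles⁺ ra rb (≤-trans (proj₂ rb) (MagicBounds.δ≤2*a bounds))
      (magicBounds⇒triangleCond bounds rb)

  -- Of p and p + 1 one is even and one odd, each below the bound of its own
  -- parity; as C₀ is even and C₁ odd, p + 1 is then below both.
  consecutive-perimeters< : Even C₀ → Odd C₁ → ∀ {p m m′} →
    TriangleCond P p m → TriangleCond P (suc p) m′ → suc p < C P
  consecutive-perimeters< evenC₀ oddC₁ {p} T T′ with even⊎odd p
  ... | inj₁ even = ⊓-glb (same-parity-<⇒suc< (trans even (sym evenC₀)) (proj₂ T even))
                          (proj₂ (proj₂ (proj₁ T′ (even⇒odd-suc {p} even))))
  ... | inj₂ odd  = ⊓-glb (proj₂ T′ (odd⇒even-suc {p} odd))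
                          (same-parity-<⇒suc< (trans odd (sym oddC₁)) (proj₂ (proj₂ (proj₁ T odd))))

  allowed-isosceles⇒magicBounds : 2 ≤ δ → Even C₀ → Odd C₁ → ∀ {a} → InRange P a →
    (∀ b → InRange P b → Allowed P a a b) → MagicBounds a
  allowed-isosceles⇒magicBounds 2≤δ evenC₀ oddC₁ {a} (1≤a , _) allowed = record
    { K₁≤a    = 2*m<2*n+1⇒m≤n (proj₁ T₁-odd)
    ; δ≤2*a   = proj₁ (allowed-isosceles⁻ (allowed δ (1≤δ , ≤-refl)))
    ; a≤K₂    = 2*m+1<2*n+2⇒m≤n
                  (subst (λ m → 2 * a + 1 < 2 * K₂ + 2 * m) (m≥n⇒m⊓n≡n 1≤a) (proj₁ (proj₂ T₁-odd)))
    ; 2*a+δ<C = subst (_< C P) (sym 2*a+δ≡1+2*a+d)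
                  (consecutive-perimeters< evenC₀ oddC₁ {m = a ⊓ d} {m′ = a ⊓ δ}
                    (triangleCond d (1≤d , m∸n≤m δ 1)) Tδ)
    }
    where
    1≤δ : 1 ≤ δ
    1≤δ = ≤-trans (s≤s z≤n) 2≤δ

    triangleCond : ∀ b → InRange P b → TriangleCond P (2 * a + b) (a ⊓ b)
    triangleCond b rb = proj₂ (allowed-isosceles⁻ (allowed b rb))

    T₁-odd : 2 * K₁ < 2 * a + 1 × 2 * a + 1 < 2 * K₂ + 2 * (a ⊓ 1) × 2 * a + 1 < C₁
    T₁-odd = proj₁ (triangleCond 1 (≤-refl , 1≤δ)) ([2*m+n]%2≡n%2 a 1)

    d : ℕ
    d = δ ∸ 1

    1≤d : 1 ≤ d
    1≤d = m+n≤o⇒m≤o∸n 1 2≤δ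

    2*a+δ≡1+2*a+d : 2 * a + δ ≡ suc (2 * a + d)
    2*a+δ≡1+2*a+d = trans (cong (2 * a +_) (sym (m+[n∸m]≡n 1≤δ))) (+-suc (2 * a) d)

    Tδ : TriangleCond P (suc (2 * a + d)) (a ⊓ δ)
    Tδ = subst (λ p → TriangleCond P p (a ⊓ δ)) 2*a+δ≡1+2*a+d (triangleCond δ (1≤δ , ≤-refl))

mainTheorem5 : (P : Params) → Admissible P →
    ∀ (a : ℕ) → Magic P a ⇔ (InRange P a × (∀ (b : ℕ) → InRange P b → Allowed P a a b))
mainTheorem5 P ((3≤δ , _ , _ , _ , _ , _ , _ , _ , evenC₀ , oddC₁) , _) a = mk⇔
  (λ magic → let (ra , bounds) = Equivalence.to (magic⇔magicBounds P) magic in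
    ra , magicBounds⇒allowed-isosceles P ra bounds)
  (λ (ra , allowed) → Equivalence.from (magic⇔magicBounds P)
    (ra , allowed-isosceles⇒magicBounds P (<⇒≤ 3≤δ) evenC₀ oddC₁ ra allowed))
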